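{- Let $m,f,d$ be positive integers with $d<f$, and let $r$ be an integer with $0 \le r \le m-1$ and $r \equiv f - r \pmod m$. Then $|S(r)| = I(r)$ and $w_{(m,f,d)}(S(r)) \le 1.618^{|S(r)|}$.
   Context: Let $\varphi = \frac{1+\sqrt5}{2}$. For $0 \le r \le m-1$, $S(r)$ is the set of integers in $[m,f]$ congruent to $r$ or to $f-r$ modulo $m$, and $I(r)$ is the number of integers in $[m,f]$ congruent to $r$ modulo $m$. For a finite set $S$ of positive integers, a subset $U \subseteq S$ is $(m,f,d)$-admissible if no two (not necessarily distinct) elements of $U$ sum to $f+m$, and whenever $x \in U$ and $x+m \in S$, also $x + m \in U$. Let $\mathcal{A}(S)$ be the set of admissible subsets of $S$. For $U \in \mathcal{A}(S)$, let $E(U,S)$ be the set of $x \in S$ with $x \notin U$, $x+m \notin U$, and $x-d \in U$; let $E'(U,S)$ be the set of $x \in U$ with $x+m \in U$; and let $s(U,S) = |E(U,S)| - |E'(U,S)|$. The weight is $w_{(m,f,d)}(S) = \sum_{U \in \mathcal{A}(S)} \varphi^{ -s(U,S)}$ (equal to $1$ if $S$ is empty). -}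

module Defs where

open import Data.Bool using (Bool; true; false; _∧_; _∨_; not; if_then_else_)
open import Data.Nat as ℕ using (ℕ; zero; suc; _≡ᵇ_; _<ᵇ_; _≤ᵇ_)
import Data.Nat.Divisibility as ℕD
open import Data.Integer as ℤ using (ℤ; +_; -[1+_]; ∣_∣)
import Data.Integer.Divisibility as ℤD
open import Data.Rational as ℚ using (ℚ; ½; -½; 0ℚ; 1ℚ)
import Data.Rational.Properties as ℚP
open import Data.List using (List; []; _∷_; map; _++_; filterᵇ; length; foldr; upTo)
open import Data.Bool.ListAction using (any; all)
open import Data.Product using (_×_)
open import Data.Sum using (_⊎_)
open import Relation.Nullary.Decidable using (⌊_⌋)

_≡_[mod_] : ℤ → ℤ → ℕ → Set
a ≡ b [mod m ] = (+ m) ℤD.∣ (a ℤ.- b)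

-- Boolean decision of the same relation (ℤ-divisibility is defined as
-- ℕ-divisibility of absolute values).
cong? : ℤ → ℤ → ℕ → Bool
cong? a b m = ⌊ m ℕD.∣? ∣ a ℤ.- b ∣ ⌋

-- Finite sets of naturals as duplicate-free lists.

_∈ᵇ_ : ℕ → List ℕ → Bool
x ∈ᵇ U = any (x ≡ᵇ_) U

interval : ℕ → ℕ → List ℕ
interval a b = filterᵇ (a ≤ᵇ_) (upTo (suc b))

subsets : List ℕ → List (List ℕ)
subsets [] = [] ∷ []
subsets (x ∷ xs) = map (x ∷_) (subsets xs) ++ subsets xs

S : (m f r : ℕ) → List ℕ
S m f r = filterᵇ (λ x → cong? (+ x) (+ r) m ∨ cong? (+ x) (+ f ℤ.- + r) m) (interval m f)

I : (m f r : ℕ) → ℕ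
I m f r = length (filterᵇ (λ x → cong? (+ x) (+ r) m) (interval m f))

admissibleᵇ : (m f d : ℕ) → List ℕ → List ℕ → Bool
admissibleᵇ m f d Sset U =
  all (λ x → all (λ y → not ((x ℕ.+ y) ≡ᵇ (f ℕ.+ m))) U) U
  ∧ all (λ x → not ((x ℕ.+ m) ∈ᵇ Sset) ∨ ((x ℕ.+ m) ∈ᵇ U)) U

𝒜 : (m f d : ℕ) → List ℕ → List (List ℕ)
𝒜 m f d Sset = filterᵇ (admissibleᵇ m f d Sset) (subsets Sset)

-- E(U,S): x ∈ S, x ∉ U, x+m ∉ U, x-d ∈ U  (x - d ∈ U means d < x and x ∸ d ∈ U)
E : (m f d : ℕ) → List ℕ → List ℕ → List ℕ
E m f d U Sset = filterᵇ
  (λ x → not (x ∈ᵇ U) ∧ not ((x ℕ.+ m) ∈ᵇ U) ∧ (d <ᵇ x) ∧ ((x ℕ.∸ d) ∈ᵇ U)) Sset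

E′ : (m f d : ℕ) → List ℕ → List ℕ → List ℕ
E′ m f d U Sset = filterᵇ (λ x → (x ℕ.+ m) ∈ᵇ U) U

s : (m f d : ℕ) → List ℕ → List ℕ → ℤ
s m f d U Sset = + length (E m f d U Sset) ℤ.- + length (E′ m f d U Sset)

five : ℚ
five = + 5 ℚ./ 1

record ℚ√5 : Set where
  constructor _+_√5
  field
    re im : ℚ
open ℚ√5 public

_⊕_ : ℚ√5 → ℚ√5 → ℚ√5
(a + b √5) ⊕ (c + d √5) = (a ℚ.+ c) + (b ℚ.+ d) √5

_⊗_ : ℚ√5 → ℚ√5 → ℚ√5
(a + b √5) ⊗ (c + d √5) =
  (a ℚ.* c ℚ.+ five ℚ.* (b ℚ.* d)) + (a ℚ.* d ℚ.+ b ℚ.* c) √5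

embed : ℚ → ℚ√5
embed q = q + 0ℚ √5

one : ℚ√5
one = embed 1ℚ

_^ℕ_ : ℚ√5 → ℕ → ℚ√5
x ^ℕ zero = one
x ^ℕ suc n = x ⊗ (x ^ℕ n)

φ : ℚ√5
φ = ½ + ½ √5

φ⁻¹ : ℚ√5
φ⁻¹ = -½ + ½ √5

φ^ : ℤ → ℚ√5
φ^ (+ n) = φ ^ℕ n
φ^ -[1+ n ] = φ⁻¹ ^ℕ suc n

-- x + y√5 ≥ 0 as a real number
NonNeg : ℚ√5 → Set
NonNeg (x + y √5) =
  (0ℚ ℚ.≤ x × 0ℚ ℚ.≤ y)
  ⊎ (0ℚ ℚ.≤ x × y ℚ.< 0ℚ × five ℚ.* (y ℚ.* y) ℚ.≤ x ℚ.* x)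
  ⊎ (x ℚ.< 0ℚ × 0ℚ ℚ.< y × x ℚ.* x ℚ.≤ five ℚ.* (y ℚ.* y))

_≤√_ : ℚ√5 → ℚ√5 → Set
(a + b √5) ≤√ (c + d √5) = NonNeg ((c ℚ.- a) + (d ℚ.- b) √5)

-- The weight w_{(m,f,d)}(S) = Σ_{U ∈ 𝒜(S)} φ^{-s(U,S)}  (= 1 for S empty,
-- since then 𝒜(S) = {∅} and s = 0).

w : (m f d : ℕ) → List ℕ → ℚ√5
w m f d Sset = foldr (λ U acc → φ^ (ℤ.- s m f d U Sset) ⊕ acc) (embed 0ℚ) (𝒜 m f d Sset)

module Submission where

-- Since 2r ≡ f (mod m), both residue classes defining S(r) are the class of r, so S(r) is the
-- progression a, a + m, …, a + (k − 1)m with a = m + r; and f − (a + (k − 1)m) ∈ [0, m) is ≡ r,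
-- hence equals r, so a + a + (k − 1)m = f + m: the map x ↦ f + m − x reverses S(r).
-- Up-closure forces an admissible U to be a tail of S(r), and by the symmetry the tail of length t
-- contains no two elements summing to f + m iff 2t ≤ k. For a tail, E(U) = ∅ (everything outside
-- U lies below U) and E′(U) is U minus its last element, so w = 1 + φ⁰ + ⋯ + φ^(J−1) with 2J ≤ k.
-- For z = x + y√5 with x, y ≥ 0 the rational x + 3y dominates z (√5 < 3) and at most doubles under
-- both z ↦ φz and the recursion of this sum, so w ≤ 2^J ≤ 1.618^(2J) ≤ 1.618^k because 1.618² ≥ 2.

open import Data.Bool using (Bool; true; false; T; not; _∧_; _∨_)
open import Data.Bool.Properties using (T-∧; T-∨; T?)
open import Data.Bool.ListAction using (all)
open import Data.Empty using (⊥-elim)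
open import Data.Integer as ℤ using (ℤ; +_; ∣_∣; _-_)
import Data.Integer.Divisibility.Signed as Sg
import Data.Integer.Properties as ℤP
open import Data.Integer.Solver using () renaming (module +-*-Solver to ℤ-Solver)
open import Data.List using (List; []; _∷_; _++_; map; length; filterᵇ; foldr; tails; upTo)
import Data.List.Properties as Listₚ
open import Data.List.Membership.Propositional using (_∈_; _∉_)
import Data.List.Membership.Propositional.Properties as ∈ₚ
open import Data.List.Relation.Binary.Subset.Propositional using (_⊆_)
open import Data.List.Relation.Unary.All as All using (All; []; _∷_)
import Data.List.Relation.Unary.All.Properties as Allₚ
open import Data.List.Relation.Unary.Any as Any using (here; there)
import Data.List.Relation.Unary.Any.Properties as Anyₚ
open import Data.Nat as ℕ using (ℕ; zero; suc; _+_; _*_; _∸_; _<_; _≤_; _≤ᵇ_; _≡ᵇ_; _<ᵇ_; z≤n; s≤s)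
import Data.Nat.Divisibility as ℕD
import Data.Nat.Properties as ℕP
open import Data.Nat.Solver using (module +-*-Solver)
open import Data.Product using (∃-syntax; _×_; _,_; proj₁; proj₂)
open import Data.Rational as ℚ using (ℚ; 0ℚ; 1ℚ; ½; _/_)
import Data.Rational.Properties as ℚP
open import Data.Rational.Solver using () renaming (module +-*-Solver to ℚ-Solver)
open import Data.Sum using (inj₁; inj₂)
open import Function using (_∘_; id)
open import Function.Bundles using (Equivalence)
open import Relation.Binary.Definitions using (tri<; tri≈; tri>)
open import Relation.Binary.PropositionalEquality
open import Relation.Nullary using (¬_; yes; no; contradiction)
open import Relation.Nullary.Decidable using (toWitness; fromWitness; from-yes)

open import Defs

open +-*-Solver using (solve; _:=_; _:+_; _:*_; con)
open ℤ-Solver using ()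
  renaming (solve to ℤsolve; _:=_ to _:=ℤ_; _:+_ to _:+ℤ_; _:-_ to _:-ℤ_; _:*_ to _:*ℤ_; con to conℤ)
open ℚ-Solver using ()
  renaming (solve to ℚsolve; _:=_ to _:=ℚ_; _:+_ to _:+ℚ_; _:*_ to _:*ℚ_; con to conℚ; :-_ to :-ℚ_)

T-not⁺ : ∀ {b} → ¬ T b → T (not b)
T-not⁺ {false} _ = _
T-not⁺ {true} ¬b = ¬b _

T-not⁻ : ∀ {b} → T (not b) → ¬ T b
T-not⁻ {false} _ ()

T-implication⁺ : ∀ {a b} → (T a → T b) → T (not a ∨ b)
T-implication⁺ {false} _ = _
T-implication⁺ {true} a⇒b = a⇒b _

T-implication⁻ : ∀ {a b} → T (not a ∨ b) → T a → T b
T-implication⁻ {true} b _ = b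

∈ᵇ⇒∈ : ∀ {x} xs → T (x ∈ᵇ xs) → x ∈ xs
∈ᵇ⇒∈ {x} xs x∈xs = Any.map (ℕP.≡ᵇ⇒≡ x _) (Anyₚ.any⁻ (x ≡ᵇ_) xs x∈xs)

∈⇒∈ᵇ : ∀ {x xs} → x ∈ xs → T (x ∈ᵇ xs)
∈⇒∈ᵇ {x} x∈xs = Anyₚ.any⁺ (x ≡ᵇ_) (Any.map (ℕP.≡⇒≡ᵇ x _) x∈xs)

filterᵇ-filterᵇ : ∀ {A : Set} (p q : A → Bool) xs →
                  filterᵇ q (filterᵇ p xs) ≡ filterᵇ (λ x → p x ∧ q x) xs
filterᵇ-filterᵇ p q [] = refl
filterᵇ-filterᵇ p q (x ∷ xs) with p x
... | false = filterᵇ-filterᵇ p q xs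
... | true with q x
...   | true = cong (x ∷_) (filterᵇ-filterᵇ p q xs)
...   | false = filterᵇ-filterᵇ p q xs

filterᵇ-upTo-suc : ∀ (p : ℕ → Bool) n →
                   filterᵇ p (upTo (suc n)) ≡ filterᵇ p (upTo n) ++ filterᵇ p (n ∷ [])
filterᵇ-upTo-suc p n =
  trans (cong (filterᵇ p) (sym (Listₚ.upTo-∷ʳ n))) (Listₚ.filter-++ (T? ∘ p) (upTo n) (n ∷ []))

progression : ℕ → ℕ → ℕ → List ℕ
progression b m zero = []
progression b m (suc t) = b ∷ progression (b + m) m t

progression-next : ∀ b m j → b + j * m + m ≡ b + suc j * m
progression-next = solve 3 (λ b m j → b :+ j :* m :+ m := b :+ (con 1 :+ j) :* m) refl

length-progression : ∀ b m t → length (progression b m t) ≡ t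
length-progression b m zero = refl
length-progression b m (suc t) = cong suc (length-progression (b + m) m t)

∈-progression⁺ : ∀ {b m t j} → j < t → b + j * m ∈ progression b m t
∈-progression⁺ {b} {m} {suc t} {zero} _ = here (ℕP.+-identityʳ b)
∈-progression⁺ {b} {m} {suc t} {suc j} (s≤s j<t) =
  there (subst (_∈ progression (b + m) m t) (ℕP.+-assoc b m (j * m)) (∈-progression⁺ j<t))

∈-progression⁻ : ∀ {b m t x} → x ∈ progression b m t → ∃[ j ] j < t × x ≡ b + j * m
∈-progression⁻ {b} {m} {suc t} (here x≡b) = 0 , s≤s z≤n , trans x≡b (sym (ℕP.+-identityʳ b))
∈-progression⁻ {b} {m} {suc t} (there x∈) with ∈-progression⁻ x∈
... | j , j<t , x≡ = suc j , s≤s j<t , trans x≡ (ℕP.+-assoc b m (j * m))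

progression-snoc : ∀ b m t → progression b m (suc t) ≡ progression b m t ++ b + t * m ∷ []
progression-snoc b m zero = cong (_∷ []) (sym (ℕP.+-identityʳ b))
progression-snoc b m (suc t) = cong (b ∷_) (begin
    progression (b + m) m (suc t)
  ≡⟨ progression-snoc (b + m) m t ⟩
    progression (b + m) m t ++ b + m + t * m ∷ []
  ≡⟨ cong (λ x → progression (b + m) m t ++ x ∷ []) (ℕP.+-assoc b m (t * m)) ⟩
    progression (b + m) m t ++ b + suc t * m ∷ []
  ∎)
  where open ≡-Reasoning

progression-≤-last : ∀ {b m t x} → x ∈ progression b m (suc t) → x ≤ b + t * m
progression-≤-last {b} {m} x∈ with ∈-progression⁻ x∈
... | j , s≤s j≤t , refl = ℕP.+-monoʳ-≤ b (ℕP.*-monoˡ-≤ m j≤t)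

progression-≥ : ∀ {b m t x} → x ∈ progression b m t → b ≤ x
progression-≥ {b} x∈ with ∈-progression⁻ x∈
... | j , _ , refl = ℕP.m≤m+n b _

module _ {m : ℕ} .{{_ : ℕ.NonZero m}} where

  progression-< : ∀ {b t x} → x ∈ progression b m t → x < b + t * m
  progression-< {b} x∈ with ∈-progression⁻ x∈
  ... | j , j<t , refl = ℕP.+-monoʳ-< b (ℕP.*-monoˡ-< m j<t)

  progression-index-injective : ∀ b {i j} → b + i * m ≡ b + j * m → i ≡ j
  progression-index-injective b {i} {j} eq = ℕP.*-cancelʳ-≡ i j m (ℕP.+-cancelˡ-≡ b _ _ eq)

  progression-tail-> : ∀ {b t x} → x ∈ progression (b + m) m t → b < x
  progression-tail-> {b} x∈ = ℕP.<-≤-trans (ℕP.m<m+n b (ℕ.>-nonZero⁻¹ m)) (progression-≥ x∈)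

all-∈⁺ : ∀ {A : Set} (p : A → Bool) {xs} → (∀ {x} → x ∈ xs → T (p x)) → T (all p xs)
all-∈⁺ p h = Allₚ.all⁻ p (All.tabulate h)

all-∈⁻ : ∀ {A : Set} (p : A → Bool) {xs x} → T (all p xs) → x ∈ xs → T (p x)
all-∈⁻ p {xs} h = All.lookup (Allₚ.all⁺ p xs h)

subsets-All : ∀ {P : ℕ → Set} {xs} → All P xs → All (All P) (subsets xs)
subsets-All [] = [] ∷ []
subsets-All (px ∷ pxs) = Allₚ.++⁺ (Allₚ.map⁺ (All.map (px ∷_) ih)) ih
  where ih = subsets-All pxs

record Admissible (m f : ℕ) (Sset U : List ℕ) : Set where
  field
    pair-free : ∀ {x y} → x ∈ U → y ∈ U → x + y ≢ f + m
    up-closed : ∀ {x} → x ∈ U → x + m ∈ Sset → x + m ∈ U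

module _ {m f d : ℕ} {Sset U : List ℕ} where

  admissibleᵇ-sound : T (admissibleᵇ m f d Sset U) → Admissible m f Sset U
  admissibleᵇ-sound adm = record
    { pair-free = λ x∈ y∈ x+y≡ →
        T-not⁻ (all-∈⁻ _ (all-∈⁻ _ pairs x∈) y∈) (ℕP.≡⇒≡ᵇ _ _ x+y≡)
    ; up-closed = λ x∈ x+m∈S →
        ∈ᵇ⇒∈ U (T-implication⁻ (all-∈⁻ _ closed x∈) (∈⇒∈ᵇ x+m∈S))
    }
    where
    pairs = proj₁ (Equivalence.to T-∧ adm)
    closed = proj₂ (Equivalence.to T-∧ adm)

  admissibleᵇ-complete : Admissible m f Sset U → T (admissibleᵇ m f d Sset U)
  admissibleᵇ-complete adm = Equivalence.from T-∧
    ( all-∈⁺ _ (λ x∈ → all-∈⁺ _ (λ y∈ → T-not⁺ (pair-free x∈ y∈ ∘ ℕP.≡ᵇ⇒≡ _ _)))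
    , all-∈⁺ _ (λ x∈ → T-implication⁺ (∈⇒∈ᵇ ∘ up-closed x∈ ∘ ∈ᵇ⇒∈ Sset)))
    where open Admissible adm

module _ (m f d : ℕ) .{{_ : ℕ.NonZero m}} (Sset : List ℕ) where

  private
    adm : List ℕ → Bool
    adm = admissibleᵇ m f d Sset

  gap-not-admissible : ∀ {P V z} → z ∈ P → z + m ∈ Sset →
                       All (_< z + m) P → All (z + m <_) V → ¬ T (adm (P ++ V))
  gap-not-admissible {P} z∈P z+m∈S P< <V isAdm
    with ∈ₚ.∈-++⁻ P (Admissible.up-closed (admissibleᵇ-sound {d = d} isAdm) (∈ₚ.∈-++⁺ˡ z∈P) z+m∈S)
  ... | inj₁ z+m∈P = ℕP.<-irrefl refl (All.lookup P< z+m∈P)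
  ... | inj₂ z+m∈V = ℕP.<-irrefl refl (All.lookup <V z+m∈V)

  -- An extension of P that omits z + m breaks up-closure at z; one that contains it extends P ++ [z + m].
  admissible-extensions :
    ∀ {P z t} → z ∈ P → All (_< z + m) P → progression (z + m) m t ⊆ Sset →
    filterᵇ adm (map (P ++_) (subsets (progression (z + m) m t)))
      ≡ filterᵇ adm ((P ++ progression (z + m) m t) ∷ [])
  admissible-extensions {P} {z} {zero} _ _ _ = refl
  admissible-extensions {P} {z} {suc t} z∈P P< prog⊆S = begin
      filterᵇ adm (map (P ++_) (map (b ∷_) subs ++ subs))
    ≡⟨ cong (filterᵇ adm) (Listₚ.map-++ (P ++_) (map (b ∷_) subs) subs) ⟩
      filterᵇ adm (map (P ++_) (map (b ∷_) subs) ++ map (P ++_) subs)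
    ≡⟨ Listₚ.filter-++ (T? ∘ adm) (map (P ++_) (map (b ∷_) subs)) (map (P ++_) subs) ⟩
      filterᵇ adm (map (P ++_) (map (b ∷_) subs)) ++ filterᵇ adm (map (P ++_) subs)
    ≡⟨ cong₂ _++_ (cong (filterᵇ adm) with-b) without-b ⟩
      filterᵇ adm (map ((P ++ b ∷ []) ++_) subs) ++ []
    ≡⟨ Listₚ.++-identityʳ _ ⟩
      filterᵇ adm (map ((P ++ b ∷ []) ++_) subs)
    ≡⟨ admissible-extensions (∈ₚ.∈-++⁺ʳ P (here refl)) P′< (prog⊆S ∘ there) ⟩
      filterᵇ adm (((P ++ b ∷ []) ++ rest) ∷ [])
    ≡⟨ cong (λ V → filterᵇ adm (V ∷ [])) (Listₚ.++-assoc P (b ∷ []) rest) ⟩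
      filterᵇ adm ((P ++ b ∷ rest) ∷ [])
    ∎
    where
    open ≡-Reasoning
    b = z + m
    rest = progression (b + m) m t
    subs = subsets rest
    with-b : map (P ++_) (map (b ∷_) subs) ≡ map ((P ++ b ∷ []) ++_) subs
    with-b = trans (sym (Listₚ.map-∘ subs)) (Listₚ.map-cong (λ V → sym (Listₚ.++-assoc P (b ∷ []) V)) subs)
    without-b : filterᵇ adm (map (P ++_) subs) ≡ []
    without-b = Listₚ.filter-none (T? ∘ adm) (Allₚ.map⁺ {f = P ++_} (All.map
      (λ {V} → gap-not-admissible {P} {V} z∈P (prog⊆S (here refl)) P<)
      (subsets-All {xs = rest} (All.tabulate progression-tail->))))
    P′< : All (_< b + m) (P ++ b ∷ [])
    P′< = Allₚ.++⁺ (All.map (λ x<b → ℕP.<-trans x<b b<b+m) P<) (b<b+m ∷ [])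
      where b<b+m = ℕP.m<m+n b (ℕ.>-nonZero⁻¹ m)

  admissible-subsets≡admissible-tails :
    ∀ {b t} → progression b m t ⊆ Sset →
    filterᵇ adm (subsets (progression b m t)) ≡ filterᵇ adm (tails (progression b m t))
  admissible-subsets≡admissible-tails {b} {zero} _ = refl
  admissible-subsets≡admissible-tails {b} {suc t} prog⊆S = begin
      filterᵇ adm (map (b ∷_) subs ++ subs)
    ≡⟨ Listₚ.filter-++ (T? ∘ adm) (map (b ∷_) subs) subs ⟩
      filterᵇ adm (map (b ∷_) subs) ++ filterᵇ adm subs
    ≡⟨ cong₂ _++_ (admissible-extensions (here refl) (ℕP.m<m+n b (ℕ.>-nonZero⁻¹ m) ∷ []) (prog⊆S ∘ there))
                  (admissible-subsets≡admissible-tails (prog⊆S ∘ there)) ⟩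
      filterᵇ adm ((b ∷ rest) ∷ []) ++ filterᵇ adm (tails rest)
    ≡⟨ Listₚ.filter-++ (T? ∘ adm) ((b ∷ rest) ∷ []) (tails rest) ⟨
      filterᵇ adm (tails (b ∷ rest))
    ∎
    where
    open ≡-Reasoning
    rest = progression (b + m) m t
    subs = subsets rest

E≡[] : ∀ {m} f d {Sset U} → (∀ {x} → x ∈ Sset → x ∉ U → All (x <_) U) → E m f d U Sset ≡ []
E≡[] {m} f d {U = U} below = Listₚ.filter-none (T? ∘ _) (All.tabulate λ {x} x∈S inE →
  let x∉U , rest₁ = Equivalence.to T-∧ inE
      _ , rest₂ = Equivalence.to (T-∧ {not ((x + m) ∈ᵇ U)}) rest₁
      _ , x∸d∈U = Equivalence.to (T-∧ {d <ᵇ x}) rest₂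
  in ℕP.<-irrefl refl (ℕP.≤-<-trans (ℕP.m∸n≤m x d)
       (All.lookup (below x∈S (T-not⁻ x∉U ∘ ∈⇒∈ᵇ)) (∈ᵇ⇒∈ U x∸d∈U))))

module _ {m : ℕ} .{{_ : ℕ.NonZero m}} (f d : ℕ) {Sset : List ℕ} where

  length-E′-progression : ∀ b t → length (E′ m f d (progression b m (suc t)) Sset) ≡ t
  length-E′-progression b t = begin
      length (filterᵇ has-next U)
    ≡⟨ cong (length ∘ filterᵇ has-next) (progression-snoc b m t) ⟩
      length (filterᵇ has-next (progression b m t ++ last ∷ []))
    ≡⟨ cong length (Listₚ.filter-++ (T? ∘ has-next) (progression b m t) (last ∷ [])) ⟩
      length (filterᵇ has-next (progression b m t) ++ filterᵇ has-next (last ∷ []))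
    ≡⟨ cong₂ (λ (xs ys : List ℕ) → length (xs ++ ys))
         (Listₚ.filter-all (T? ∘ has-next) (All.tabulate not-last))
         (Listₚ.filter-reject (T? ∘ has-next) {x = last} {xs = []} last-has-no-next) ⟩
      length (progression b m t ++ [])
    ≡⟨ cong length (Listₚ.++-identityʳ (progression b m t)) ⟩
      length (progression b m t)
    ≡⟨ length-progression b m t ⟩
      t
    ∎
    where
    open ≡-Reasoning
    U = progression b m (suc t)
    last = b + t * m
    has-next : ℕ → Bool
    has-next x = (x + m) ∈ᵇ U
    not-last : ∀ {x} → x ∈ progression b m t → T (has-next x)
    not-last x∈ with ∈-progression⁻ x∈
    ... | j , j<t , refl = ∈⇒∈ᵇ (subst (_∈ U) (sym (progression-next b m j)) (∈-progression⁺ (s≤s j<t)))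
    last-has-no-next : ¬ T (has-next last)
    last-has-no-next last+m∈U = ℕP.<-irrefl (progression-next b m t) (progression-< (∈ᵇ⇒∈ U last+m∈U))

-- The base case is written `one ⊕ embed 0ℚ`, which is literally the term `w` contributes for ∅.
φ-series : ℕ → ℚ√5
φ-series zero = one ⊕ embed 0ℚ
φ-series (suc n) = (φ ^ℕ n) ⊕ φ-series n

module _ {m : ℕ} .{{_ : ℕ.NonZero m}} (f d a k′ : ℕ) (symmetric : a + a + k′ * m ≡ f + m) where

  private
    k : ℕ
    k = suc k′

    Sset : List ℕ
    Sset = progression a m k

    adm : List ℕ → Bool
    adm = admissibleᵇ m f d Sset

  -- `b ≡ a + i * m` and `i + t ≡ k` say that `progression b m t` is the tail of `Sset` from index i.
  tail-shift : ∀ {b i} → b ≡ a + i * m → b + m ≡ a + suc i * m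
  tail-shift {i = i} b≡ = trans (cong (_+ m) b≡) (progression-next a m i)

  tail-up-closed : ∀ {b i t x} → b ≡ a + i * m → i + t ≡ k →
                   x ∈ progression b m t → x + m ∈ Sset → x + m ∈ progression b m t
  tail-up-closed {b} {i} {t} refl i+t≡k x∈ x+m∈S with ∈-progression⁻ x∈ | ∈-progression⁻ x+m∈S
  ... | j , j<t , refl | j′ , j′<k , x+m≡ =
    subst (_∈ progression b m t) (sym (progression-next b m j)) (∈-progression⁺ 1+j<t)
    where
    j′≡ : j′ ≡ i + suc j
    j′≡ = progression-index-injective a (trans (sym x+m≡)
      (solve 4 (λ a i j m → a :+ i :* m :+ j :* m :+ m := a :+ (i :+ (con 1 :+ j)) :* m) refl a i j m))
    1+j<t : suc j < t
    1+j<t = ℕP.+-cancelˡ-< i _ _ (subst₂ _<_ j′≡ (sym i+t≡k) j′<k)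

  f+m<b+b : ∀ {b i} → b ≡ a + i * m → k ≤ i + i → f + m < b + b
  f+m<b+b {b} {i} refl k≤2i = begin-strict
      f + m                    ≡⟨ symmetric ⟨
      a + a + k′ * m           <⟨ ℕP.+-monoʳ-< (a + a) (ℕP.*-monoˡ-< m (ℕP.n<1+n k′)) ⟩
      a + a + k * m            ≤⟨ ℕP.+-monoʳ-≤ (a + a) (ℕP.*-monoˡ-≤ m k≤2i) ⟩
      a + a + (i + i) * m      ≡⟨ solve 3 (λ a i m → a :+ a :+ (i :+ i) :* m := a :+ i :* m :+ (a :+ i :* m))
                                         refl a i m ⟩
      a + i * m + (a + i * m)  ∎
    where open ℕP.≤-Reasoning

  tail-admissible : ∀ {b i t} → b ≡ a + i * m → i + t ≡ k → k ≤ i + i →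
                    T (adm (progression b m t))
  tail-admissible {b} {i} b≡ i+t≡k k≤2i = admissibleᵇ-complete {d = d} {Sset = Sset} record
    { pair-free = λ x∈ y∈ x+y≡f+m → ℕP.<-irrefl (sym x+y≡f+m)
        (ℕP.<-≤-trans (f+m<b+b {i = i} b≡ k≤2i) (ℕP.+-mono-≤ (progression-≥ x∈) (progression-≥ y∈)))
    ; up-closed = tail-up-closed {i = i} b≡ i+t≡k
    }

  tail-not-admissible : ∀ {b i t} → b ≡ a + i * m → i + t ≡ k → i + i < k →
                        ¬ T (adm (progression b m t))
  tail-not-admissible {b} {i} {t} refl i+t≡k 2i<k isAdm =
    Admissible.pair-free (admissibleᵇ-sound {d = d} {Sset = Sset} isAdm)
      (subst (_∈ progression b m t) (ℕP.+-identityʳ b) (∈-progression⁺ (ℕP.≤-<-trans z≤n e<t)))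
      (∈-progression⁺ e<t)
      pair-sum
    where
    e = k′ ∸ (i + i)
    2i+e≡k′ : i + i + e ≡ k′
    2i+e≡k′ = ℕP.m+[n∸m]≡n (ℕP.≤-pred 2i<k)
    e<t : e < t
    e<t = ℕP.+-cancelˡ-< i e t (begin-strict
        i + e      ≤⟨ ℕP.m≤n+m (i + e) i ⟩
        i + (i + e) ≡⟨ trans (sym (ℕP.+-assoc i i e)) 2i+e≡k′ ⟩
        k′         <⟨ ℕP.n<1+n k′ ⟩
        k          ≡⟨ i+t≡k ⟨
        i + t      ∎)
      where open ℕP.≤-Reasoning
    pair-sum : b + (b + e * m) ≡ f + m
    pair-sum = begin
        a + i * m + (a + i * m + e * m)  ≡⟨ solve 4 (λ a i e m → a :+ i :* m :+ (a :+ i :* m :+ e :* m)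
                                                         := a :+ a :+ (i :+ i :+ e) :* m) refl a i e m ⟩
        a + a + (i + i + e) * m          ≡⟨ cong (λ n → a + a + n * m) 2i+e≡k′ ⟩
        a + a + k′ * m                   ≡⟨ symmetric ⟩
        f + m                            ∎
      where open ≡-Reasoning

  tail-E≡[] : ∀ {b i t} → b ≡ a + i * m → i + t ≡ k → E m f d (progression b m t) Sset ≡ []
  tail-E≡[] {b} {i} {t} refl i+t≡k = E≡[] f d below
    where
    below : ∀ {x} → x ∈ Sset → x ∉ progression b m t → All (x <_) (progression b m t)
    below x∈S x∉tail with ∈-progression⁻ x∈S
    ... | j , j<k , refl with i ℕ.≤? j
    ...   | yes i≤j = contradiction (subst (_∈ progression b m t) x≡ (∈-progression⁺ j∸i<t)) x∉tail
      where
      x≡ : b + (j ∸ i) * m ≡ a + j * m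
      x≡ = trans (solve 4 (λ a i m e → a :+ i :* m :+ e :* m := a :+ (i :+ e) :* m) refl a i m (j ∸ i))
                 (cong (λ n → a + n * m) (ℕP.m+[n∸m]≡n i≤j))
      j∸i<t : j ∸ i < t
      j∸i<t = ℕP.+-cancelˡ-< i _ t (subst₂ _<_ (sym (ℕP.m+[n∸m]≡n i≤j)) (sym i+t≡k) j<k)
    ...   | no i≰j = All.tabulate λ y∈ →
      ℕP.<-≤-trans (ℕP.+-monoʳ-< a (ℕP.*-monoˡ-< m (ℕP.≰⇒> i≰j))) (progression-≥ y∈)

  private
    step : List ℕ → ℚ√5 → ℚ√5
    step U acc = φ^ (ℤ.- s m f d U Sset) ⊕ acc

    fold : List (List ℕ) → ℚ√5
    fold = foldr step (embed 0ℚ)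

  -s-tail : ∀ {b i t} → b ≡ a + i * m → i + suc t ≡ k →
            ℤ.- s m f d (progression b m (suc t)) Sset ≡ + t
  -s-tail {b} {i} {t} b≡ i+t≡k
    rewrite tail-E≡[] {i = i} b≡ i+t≡k | length-E′-progression f d {Sset} b t = -[0-n]≡n t
    where
    -[0-n]≡n : ∀ n → ℤ.- (+ 0 - + n) ≡ + n
    -[0-n]≡n zero = refl
    -[0-n]≡n (suc n) = refl

  -s-[] : ℤ.- s m f d [] Sset ≡ + 0
  -s-[] rewrite tail-E≡[] {a + k * m} {k} {0} refl (ℕP.+-identityʳ k) = refl

  fold-admissible-tails : ∀ {b i t} → b ≡ a + i * m → i + t ≡ k → k ≤ i + i →
                          fold (filterᵇ adm (tails (progression b m t))) ≡ φ-series t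
  fold-admissible-tails {b} {i} {zero} _ _ _ = cong (λ z → φ^ z ⊕ embed 0ℚ) -s-[]
  fold-admissible-tails {b} {i} {suc t} b≡ i+t≡k k≤2i = begin
      fold (filterᵇ adm (U ∷ tails rest))
    ≡⟨ cong fold (Listₚ.filter-accept (T? ∘ adm) {x = U} {xs = tails rest}
                    (tail-admissible {i = i} b≡ i+t≡k k≤2i)) ⟩
      φ^ (ℤ.- s m f d U Sset) ⊕ fold (filterᵇ adm (tails rest))
    ≡⟨ cong₂ _⊕_ (cong φ^ (-s-tail {i = i} b≡ i+t≡k))
         (fold-admissible-tails {i = suc i} (tail-shift {i = i} b≡) (trans (sym (ℕP.+-suc i t)) i+t≡k)
           (ℕP.≤-trans k≤2i (ℕP.+-mono-≤ (ℕP.n≤1+n i) (ℕP.n≤1+n i)))) ⟩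
      φ-series (suc t)
    ∎
    where
    open ≡-Reasoning
    U = progression b m (suc t)
    rest = progression (b + m) m t

  fold-tails : ∀ {b i t} → b ≡ a + i * m → i + t ≡ k →
               ∃[ J ] J + J ≤ k × fold (filterᵇ adm (tails (progression b m t))) ≡ φ-series J
  fold-tails {b} {i} {t} b≡ i+t≡k with k ℕ.≤? i + i
  ... | yes k≤2i = t , subst (t + t ≤_) i+t≡k (ℕP.+-monoˡ-≤ t t≤i) , fold-admissible-tails b≡ i+t≡k k≤2i
    where t≤i = ℕP.+-cancelˡ-≤ i t i (subst (_≤ i + i) (sym i+t≡k) k≤2i)
  fold-tails {b} {i} {zero} b≡ i+0≡k | no k≰2i =
    contradiction (subst (_≤ i + i) (trans (sym (ℕP.+-identityʳ i)) i+0≡k) (ℕP.m≤m+n i i)) k≰2i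
  fold-tails {b} {i} {suc t} b≡ i+t≡k | no k≰2i
    with J , J+J≤k , fold≡ ← fold-tails {i = suc i} (tail-shift {i = i} b≡)
                                         (trans (sym (ℕP.+-suc i t)) i+t≡k) =
    J , J+J≤k , trans (cong fold skip) fold≡
    where
    skip : filterᵇ adm (tails (progression b m (suc t))) ≡ filterᵇ adm (tails (progression (b + m) m t))
    skip = Listₚ.filter-reject (T? ∘ adm) {x = progression b m (suc t)}
             (tail-not-admissible {i = i} b≡ i+t≡k (ℕP.≰⇒> k≰2i))

  weight-symmetric-progression : ∃[ J ] J + J ≤ k × w m f d Sset ≡ φ-series J
  weight-symmetric-progression
    with J , J+J≤k , fold≡ ← fold-tails {a} {0} {k} (sym (ℕP.+-identityʳ a)) refl =
    J , J+J≤k , trans (cong fold (admissible-subsets≡admissible-tails m f d Sset {a} {k} id)) fold≡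

infixr 8 _^_
_^_ : ℚ → ℕ → ℚ
q ^ zero = 1ℚ
q ^ suc n = q ℚ.* q ^ n

two three golden : ℚ
two = + 2 ℚ./ 1
three = + 3 ℚ./ 1
golden = + 1618 / 1000

0≤* : ∀ {p q} → 0ℚ ℚ.≤ p → 0ℚ ℚ.≤ q → 0ℚ ℚ.≤ p ℚ.* q
0≤* {p} {q} 0≤p 0≤q = ℚP.nonNegative⁻¹ _
  {{ℚP.nonNeg*nonNeg⇒nonNeg p {{ℚ.nonNegative 0≤p}} q {{ℚ.nonNegative 0≤q}}}}

p≤p+q : ∀ p {q} → 0ℚ ℚ.≤ q → p ℚ.≤ p ℚ.+ q
p≤p+q p 0≤q = ℚP.≤-trans (ℚP.≤-reflexive (sym (ℚP.+-identityʳ p))) (ℚP.+-monoʳ-≤ p 0≤q)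

0≤^ : ∀ {p} → 0ℚ ℚ.≤ p → ∀ n → 0ℚ ℚ.≤ p ^ n
0≤^ 0≤p zero = from-yes (0ℚ ℚP.≤? 1ℚ)
0≤^ 0≤p (suc n) = 0≤* 0≤p (0≤^ 0≤p n)

embed-^ℕ : ∀ q n → embed q ^ℕ n ≡ embed (q ^ n)
embed-^ℕ q zero = refl
embed-^ℕ q (suc n) rewrite embed-^ℕ q n = cong₂ _+_√5
  (ℚsolve 2 (λ p r → p :*ℚ r :+ℚ conℚ five :*ℚ (conℚ 0ℚ :*ℚ conℚ 0ℚ) :=ℚ p :*ℚ r) refl q (q ^ n))
  (ℚsolve 2 (λ p r → p :*ℚ conℚ 0ℚ :+ℚ conℚ 0ℚ :*ℚ r :=ℚ conℚ 0ℚ) refl q (q ^ n))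

0≤three : 0ℚ ℚ.≤ three
0≤three = from-yes (0ℚ ℚP.≤? three)

-- Since √5 < 3, y ≥ 0 and x + 3y ≤ q give x + y√5 ≤ q.
≤√-embed : ∀ {x y q} → 0ℚ ℚ.≤ y → three ℚ.* y ℚ.≤ q ℚ.- x → (x + y √5) ≤√ embed q
≤√-embed {x} {y} {q} 0≤y 3y≤q-x with ℚP.<-cmp 0ℚ y
... | tri≈ _ 0≡y _ = inj₁ (0≤q-x , subst (λ z → 0ℚ ℚ.≤ 0ℚ ℚ.- z) 0≡y ℚP.≤-refl)
  where 0≤q-x = ℚP.≤-trans (0≤* 0≤three 0≤y) 3y≤q-x
... | tri< 0<y _ _ = inj₂ (inj₁ (0≤q-x , -y<0 , squares))
  where
  -y<0 = subst (ℚ._< 0ℚ) (sym (ℚP.+-identityˡ (ℚ.- y))) (ℚP.neg-antimono-< 0<y)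
  0≤q-x = ℚP.≤-trans (0≤* 0≤three 0≤y) 3y≤q-x
  squares : five ℚ.* ((0ℚ ℚ.- y) ℚ.* (0ℚ ℚ.- y)) ℚ.≤ (q ℚ.- x) ℚ.* (q ℚ.- x)
  squares = begin
    five ℚ.* ((0ℚ ℚ.- y) ℚ.* (0ℚ ℚ.- y))
      ≤⟨ p≤p+q _ (0≤* (from-yes (0ℚ ℚP.≤? (two ℚ.+ two))) (0≤* 0≤y 0≤y)) ⟩
    five ℚ.* ((0ℚ ℚ.- y) ℚ.* (0ℚ ℚ.- y)) ℚ.+ (two ℚ.+ two) ℚ.* (y ℚ.* y)
      ≡⟨ ℚsolve 1 (λ y → conℚ five :*ℚ ((conℚ 0ℚ :+ℚ (:-ℚ y)) :*ℚ (conℚ 0ℚ :+ℚ (:-ℚ y)))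
                           :+ℚ (conℚ two :+ℚ conℚ two) :*ℚ (y :*ℚ y)
                        :=ℚ (conℚ three :*ℚ y) :*ℚ (conℚ three :*ℚ y)) refl y ⟩
    (three ℚ.* y) ℚ.* (three ℚ.* y)
      ≤⟨ ℚP.*-monoʳ-≤-nonNeg (three ℚ.* y) {{ℚ.nonNegative (0≤* 0≤three 0≤y)}} 3y≤q-x ⟩
    (q ℚ.- x) ℚ.* (three ℚ.* y)
      ≤⟨ ℚP.*-monoˡ-≤-nonNeg (q ℚ.- x) {{ℚ.nonNegative 0≤q-x}} 3y≤q-x ⟩
    (q ℚ.- x) ℚ.* (q ℚ.- x) ∎
    where open ℚP.≤-Reasoning
... | tri> _ _ y<0 = ⊥-elim (ℚP.<-irrefl refl (ℚP.<-≤-trans y<0 0≤y))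

majorant : ℚ√5 → ℚ
majorant z = re z ℚ.+ three ℚ.* im z

record Controlled (z : ℚ√5) (n : ℕ) : Set where
  field
    re-nonNeg : 0ℚ ℚ.≤ re z
    im-nonNeg : 0ℚ ℚ.≤ im z
    majorant≤ : majorant z ℚ.≤ two ^ n

⊕-controlled : ∀ {x y n} → Controlled x n → Controlled y n → Controlled (x ⊕ y) (suc n)
⊕-controlled {rx + ix √5} {ry + iy √5} {n} cx cy = record
  { re-nonNeg = ℚP.+-mono-≤ (re-nonNeg cx) (re-nonNeg cy)
  ; im-nonNeg = ℚP.+-mono-≤ (im-nonNeg cx) (im-nonNeg cy)
  ; majorant≤ = begin
      (rx ℚ.+ ry) ℚ.+ three ℚ.* (ix ℚ.+ iy)
        ≡⟨ ℚsolve 4 (λ a b x y → (a :+ℚ b) :+ℚ conℚ three :*ℚ (x :+ℚ y)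
               :=ℚ (a :+ℚ conℚ three :*ℚ x) :+ℚ (b :+ℚ conℚ three :*ℚ y)) refl rx ry ix iy ⟩
      majorant (rx + ix √5) ℚ.+ majorant (ry + iy √5)
        ≤⟨ ℚP.+-mono-≤ (majorant≤ cx) (majorant≤ cy) ⟩
      two ^ n ℚ.+ two ^ n
        ≡⟨ ℚsolve 1 (λ p → p :+ℚ p :=ℚ conℚ two :*ℚ p) refl (two ^ n) ⟩
      two ^ suc n ∎
  }
  where
  open Controlled
  open ℚP.≤-Reasoning

φ^ℕ-controlled : ∀ n → Controlled (φ ^ℕ n) n
φ^ℕ-controlled zero = record
  { re-nonNeg = from-yes (0ℚ ℚP.≤? 1ℚ)
  ; im-nonNeg = ℚP.≤-refl
  ; majorant≤ = from-yes (majorant one ℚP.≤? 1ℚ)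
  }
φ^ℕ-controlled (suc n) with φ ^ℕ n | φ^ℕ-controlled n
... | x + y √5 | record { re-nonNeg = 0≤x ; im-nonNeg = 0≤y ; majorant≤ = x+3y≤ } = record
  { re-nonNeg = ℚP.+-mono-≤ (0≤* 0≤½ 0≤x) (0≤* (from-yes (0ℚ ℚP.≤? five)) (0≤* 0≤½ 0≤y))
  ; im-nonNeg = ℚP.+-mono-≤ (0≤* 0≤½ 0≤y) (0≤* 0≤½ 0≤x)
  ; majorant≤ = begin
      majorant (φ ⊗ (x + y √5))
        ≡⟨ ℚsolve 2 (λ x y → (conℚ ½ :*ℚ x :+ℚ conℚ five :*ℚ (conℚ ½ :*ℚ y))
                              :+ℚ conℚ three :*ℚ (conℚ ½ :*ℚ y :+ℚ conℚ ½ :*ℚ x)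
                             :=ℚ conℚ two :*ℚ (x :+ℚ conℚ two :*ℚ y)) refl x y ⟩
      two ℚ.* (x ℚ.+ two ℚ.* y)
        ≤⟨ ℚP.*-monoˡ-≤-nonNeg two (ℚP.+-monoʳ-≤ x
             (ℚP.*-monoʳ-≤-nonNeg y {{ℚ.nonNegative 0≤y}} (from-yes (two ℚP.≤? three)))) ⟩
      two ℚ.* majorant (x + y √5)
        ≤⟨ ℚP.*-monoˡ-≤-nonNeg two x+3y≤ ⟩
      two ^ suc n ∎
  }
  where
  open ℚP.≤-Reasoning
  0≤½ = from-yes (0ℚ ℚP.≤? ½)

φ-series-controlled : ∀ n → Controlled (φ-series n) n
φ-series-controlled zero = record
  { re-nonNeg = from-yes (0ℚ ℚP.≤? (1ℚ ℚ.+ 0ℚ))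
  ; im-nonNeg = from-yes (0ℚ ℚP.≤? (0ℚ ℚ.+ 0ℚ))
  ; majorant≤ = from-yes (majorant (one ⊕ embed 0ℚ) ℚP.≤? 1ℚ)
  }
φ-series-controlled (suc n) = ⊕-controlled (φ^ℕ-controlled n) (φ-series-controlled n)

controlled-≤√ : ∀ {z n q} → Controlled z n → two ^ n ℚ.≤ q → z ≤√ embed q
controlled-≤√ {x + y √5} {n} {q} record { im-nonNeg = 0≤y ; majorant≤ = x+3y≤ } 2ⁿ≤q =
  ≤√-embed {x} {y} {q} 0≤y (ℚP.≤-trans
    (ℚP.≤-reflexive (ℚsolve 2 (λ x y → conℚ three :*ℚ y :=ℚ (x :+ℚ conℚ three :*ℚ y) :+ℚ (:-ℚ x))
                      refl x y))
    (ℚP.+-monoˡ-≤ (ℚ.- x) (ℚP.≤-trans x+3y≤ 2ⁿ≤q)))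

module _ {q : ℚ} (1≤q : 1ℚ ℚ.≤ q) where

  private
    0≤q : 0ℚ ℚ.≤ q
    0≤q = ℚP.≤-trans (from-yes (0ℚ ℚP.≤? 1ℚ)) 1≤q

  ^-mono-≤ : ∀ {i j} → i ≤ j → q ^ i ℚ.≤ q ^ j
  ^-mono-≤ {zero} {zero} _ = ℚP.≤-refl
  ^-mono-≤ {zero} {suc j} _ = ℚP.≤-trans (^-mono-≤ {zero} {j} z≤n)
    (ℚP.≤-trans (ℚP.≤-reflexive (sym (ℚP.*-identityˡ (q ^ j))))
      (ℚP.*-monoʳ-≤-nonNeg (q ^ j) {{ℚ.nonNegative (0≤^ 0≤q j)}} 1≤q))
  ^-mono-≤ {suc i} {suc j} (s≤s i≤j) = ℚP.*-monoˡ-≤-nonNeg q {{ℚ.nonNegative 0≤q}} (^-mono-≤ i≤j)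

  module _ (2≤q² : two ℚ.≤ q ℚ.* q) where

    two^n≤q^[n+n] : ∀ n → two ^ n ℚ.≤ q ^ (n + n)
    two^n≤q^[n+n] zero = ℚP.≤-refl
    two^n≤q^[n+n] (suc n) = begin
      two ℚ.* two ^ n                 ≤⟨ ℚP.*-monoʳ-≤-nonNeg (two ^ n) {{ℚ.nonNegative 0≤2ⁿ}} 2≤q² ⟩
      q ℚ.* q ℚ.* two ^ n             ≤⟨ ℚP.*-monoˡ-≤-nonNeg (q ℚ.* q) {{ℚ.nonNegative (0≤* 0≤q 0≤q)}}
                                           (two^n≤q^[n+n] n) ⟩
      q ℚ.* q ℚ.* q ^ (n + n)         ≡⟨ ℚP.*-assoc q q (q ^ (n + n)) ⟩
      q ^ suc (suc (n + n))           ≡⟨ cong (λ e → q ^ suc e) (ℕP.+-suc n n) ⟨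
      q ^ (suc n + suc n)             ∎
      where
      open ℚP.≤-Reasoning
      0≤2ⁿ = 0≤^ (from-yes (0ℚ ℚP.≤? two)) n

    φ-series-bound : ∀ {J k} → J + J ≤ k → φ-series J ≤√ (embed q ^ℕ k)
    φ-series-bound {J} {k} J+J≤k = subst (φ-series J ≤√_) (sym (embed-^ℕ q k))
      (controlled-≤√ (φ-series-controlled J) (ℚP.≤-trans (two^n≤q^[n+n] J) (^-mono-≤ J+J≤k)))

data SymmetricProgression (m f : ℕ) : List ℕ → Set where
  empty : SymmetricProgression m f []
  symmetric : ∀ {a k′} → a + a + k′ * m ≡ f + m → SymmetricProgression m f (progression a m (suc k′))

weight-bound : ∀ {m f d xs q} .{{_ : ℕ.NonZero m}} → 1ℚ ℚ.≤ q → two ℚ.≤ q ℚ.* q →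
               SymmetricProgression m f xs → w m f d xs ≤√ (embed q ^ℕ length xs)
weight-bound 1≤q 2≤q² empty = φ-series-bound 1≤q 2≤q² {0} {0} z≤n
weight-bound {m} {f} {d} {q = q} 1≤q 2≤q² (symmetric {a} {k′} a+a+k′m≡f+m)
  with J , J+J≤k , w≡ ← weight-symmetric-progression f d a k′ a+a+k′m≡f+m
  rewrite w≡ = φ-series-bound 1≤q 2≤q² {J} (subst (J + J ≤_) (sym (length-progression a m (suc k′))) J+J≤k)

∣+m-+n∣≡m∸n : ∀ {x y} → y ≤ x → ∣ + x - + y ∣ ≡ x ∸ y
∣+m-+n∣≡m∸n {x} {y} y≤x = cong ∣_∣ (trans (ℤP.m-n≡m⊖n x y) (ℤP.⊖-≥ y≤x))

m∣n∧n<m⇒n≡0 : ∀ {m n} → m ℕD.∣ n → n < m → n ≡ 0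
m∣n∧n<m⇒n≡0 {n = zero} _ _ = refl
m∣n∧n<m⇒n≡0 {n = suc n} m∣n n<m = contradiction m∣n (ℕD.>⇒∤ n<m)

module _ {m : ℕ} where

  congruent-via : ∀ {a b c : ℤ} → a ≡ c [mod m ] → b ≡ c [mod m ] → a ≡ b [mod m ]
  congruent-via {a} {b} {c} a≡c b≡c = Sg.∣⇒∣ᵤ (subst (Sg._∣_ (+ m)) difference
    (Sg.∣m∣n⇒∣m-n (Sg.∣ᵤ⇒∣ {+ m} {a - c} a≡c) (Sg.∣ᵤ⇒∣ {+ m} {b - c} b≡c)))
    where
    difference : (a - c) - (b - c) ≡ a - b
    difference = ℤsolve 3 (λ a b c → (a :-ℤ c) :-ℤ (b :-ℤ c) :=ℤ a :-ℤ b) refl a b c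

  residue-unique : ∀ {a b : ℕ} → a < m → b < m → (+ a) ≡ (+ b) [mod m ] → a ≡ b
  residue-unique {a} {b} a<m b<m a≡b =
    ℤP.+-injective (ℤP.i-j≡0⇒i≡j (+ a) (+ b) (ℤP.∣i∣≡0⇒i≡0 ∣a-b∣≡0))
    where
    ∣a-b∣<m : ∣ + a - + b ∣ < m
    ∣a-b∣<m = subst (_< m) (cong ∣_∣ (sym (ℤP.m-n≡m⊖n a b)))
      (ℕP.≤-<-trans (ℤP.∣m⊝n∣≤m⊔n a b) (ℕP.⊔-lub a<m b<m))
    ∣a-b∣≡0 : ∣ + a - + b ∣ ≡ 0
    ∣a-b∣≡0 = m∣n∧n<m⇒n≡0 a≡b ∣a-b∣<m

S≡congruent-interval : ∀ {m f r} → (+ r) ≡ (+ f - + r) [mod m ] →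
                       S m f r ≡ filterᵇ (λ x → cong? (+ x) (+ r) m) (interval m f)
S≡congruent-interval {m} {f} {r} r≡f-r =
  Listₚ.filter-≐ (T? ∘ _) (T? ∘ _) (one-residue , Equivalence.from T-∨ ∘ inj₁) (interval m f)
  where
  one-residue : ∀ {x} → T (cong? (+ x) (+ r) m ∨ cong? (+ x) (+ f - + r) m) → T (cong? (+ x) (+ r) m)
  one-residue {x} x≡r∨x≡f-r with Equivalence.to T-∨ x≡r∨x≡f-r
  ... | inj₁ x≡r = x≡r
  ... | inj₂ x≡f-r = fromWitness (congruent-via {m} {+ x} {+ r} {+ f - + r} (toWitness x≡f-r) r≡f-r)

module _ {m r : ℕ} .{{_ : ℕ.NonZero m}} (r<m : r < m) where

  private
    member : ℕ → Bool
    member x = (m ≤ᵇ x) ∧ cong? (+ x) (+ r) m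

  member⇒∈progression : ∀ {x} → T (member x) → ∃[ j ] x ≡ m + r + j * m
  member⇒∈progression {x} x∈ with Equivalence.to T-∧ x∈
  ... | m≤ᵇx , x≡r = from-quotient (subst (m ℕD.∣_) (∣+m-+n∣≡m∸n r≤x) (toWitness x≡r))
    where
    m≤x = ℕP.≤ᵇ⇒≤ m x m≤ᵇx
    r≤x = ℕP.<⇒≤ (ℕP.<-≤-trans r<m m≤x)
    from-quotient : m ℕD.∣ x ∸ r → ∃[ j ] x ≡ m + r + j * m
    from-quotient (ℕD.divides zero x∸r≡0) =
      contradiction (ℕP.m∸n≡0⇒m≤n x∸r≡0) (ℕP.<⇒≱ (ℕP.<-≤-trans r<m m≤x))
    from-quotient (ℕD.divides (suc j) x∸r≡[1+j]m) = j , (begin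
        x                  ≡⟨ ℕP.m∸n+n≡m r≤x ⟨
        x ∸ r + r          ≡⟨ cong (_+ r) x∸r≡[1+j]m ⟩
        m + j * m + r      ≡⟨ solve 3 (λ m r j → m :+ j :* m :+ r := m :+ r :+ j :* m) refl m r j ⟩
        m + r + j * m      ∎)
      where open ≡-Reasoning

  ∈progression⇒member : ∀ j → T (member (m + r + j * m))
  ∈progression⇒member j = Equivalence.from T-∧
    ( ℕP.≤⇒≤ᵇ (ℕP.≤-trans (ℕP.m≤m+n m r) (ℕP.m≤m+n (m + r) (j * m)))
    , fromWitness (subst (m ℕD.∣_) (sym (∣+m-+n∣≡m∸n r≤x)) (ℕD.divides (suc j) x∸r≡[1+j]m)))
    where
    r≤x = ℕP.≤-trans (ℕP.m≤n+m r m) (ℕP.m≤m+n (m + r) (j * m))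
    x∸r≡[1+j]m : m + r + j * m ∸ r ≡ suc j * m
    x∸r≡[1+j]m = trans (cong (_∸ r) (solve 3 (λ m r j → m :+ r :+ j :* m := m :+ j :* m :+ r) refl m r j))
                       (ℕP.m+n∸n≡m (m + j * m) r)

  members-upTo : ∀ N → ∃[ K ] filterᵇ member (upTo N) ≡ progression (m + r) m K
                              × All (_< N) (progression (m + r) m K)
                              × N ≤ m + r + K * m
  members-upTo zero = 0 , refl , [] , z≤n
  members-upTo (suc N) with members-upTo N | T? (member N)
  ... | K , filter≡ , <N , N≤ | yes N∈ = suc K , filter≡′ , All.tabulate (s≤s ∘ ≤N) , suc-N≤
    where
    c = m + r
    N≡ : N ≡ c + K * m
    N≡ with j , refl ← member⇒∈progression N∈ = cong (λ i → c + i * m) (ℕP.≤-antisym j≤K K≤j)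
      where
      j≤K = ℕP.*-cancelʳ-≤ j K m (ℕP.+-cancelˡ-≤ c _ _ N≤)
      K≤j = ℕP.≮⇒≥ (λ j<K → ℕP.<-irrefl refl (All.lookup <N (∈-progression⁺ j<K)))
    filter≡′ : filterᵇ member (upTo (suc N)) ≡ progression c m (suc K)
    filter≡′ = begin
        filterᵇ member (upTo (suc N))
      ≡⟨ filterᵇ-upTo-suc member N ⟩
        filterᵇ member (upTo N) ++ filterᵇ member (N ∷ [])
      ≡⟨ cong₂ _++_ filter≡ (Listₚ.filter-accept (T? ∘ member) {xs = []} N∈) ⟩
        progression c m K ++ N ∷ []
      ≡⟨ cong (λ x → progression c m K ++ x ∷ []) N≡ ⟩
        progression c m K ++ c + K * m ∷ []
      ≡⟨ progression-snoc c m K ⟨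
        progression c m (suc K)
      ∎
      where open ≡-Reasoning
    ≤N : ∀ {x} → x ∈ progression c m (suc K) → x ≤ N
    ≤N x∈ = subst (_ ≤_) (sym N≡) (progression-≤-last x∈)
    suc-N≤ : suc N ≤ c + suc K * m
    suc-N≤ = subst₂ _≤_ (cong suc (sym N≡)) (progression-next c m K) (ℕP.m<m+n (c + K * m) (ℕ.>-nonZero⁻¹ m))
  ... | K , filter≡ , <N , N≤ | no N∉ = K , filter≡′ , All.map ℕP.m<n⇒m<1+n <N , ℕP.≤∧≢⇒< N≤ N≢
    where
    filter≡′ : filterᵇ member (upTo (suc N)) ≡ progression (m + r) m K
    filter≡′ = begin
        filterᵇ member (upTo (suc N))
      ≡⟨ filterᵇ-upTo-suc member N ⟩
        filterᵇ member (upTo N) ++ filterᵇ member (N ∷ [])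
      ≡⟨ cong₂ _++_ filter≡ (Listₚ.filter-reject (T? ∘ member) {xs = []} N∉) ⟩
        progression (m + r) m K ++ []
      ≡⟨ Listₚ.++-identityʳ _ ⟩
        progression (m + r) m K
      ∎
      where open ≡-Reasoning
    N≢ : N ≢ m + r + K * m
    N≢ refl = N∉ (∈progression⇒member K)

  S-progression : ∀ {f} → (+ r) ≡ (+ f - + r) [mod m ] →
                  ∃[ K ] S m f r ≡ progression (m + r) m K × All (_≤ f) (progression (m + r) m K)
                         × f < m + r + K * m
  S-progression {f} r≡f-r with K , filter≡ , <1+f , 1+f≤ ← members-upTo (suc f) =
    K , trans (S≡congruent-interval {m} {f} {r} r≡f-r)
          (trans (filterᵇ-filterᵇ (m ≤ᵇ_) (λ x → cong? (+ x) (+ r) m) (upTo (suc f))) filter≡)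
      , All.map ℕP.≤-pred <1+f , 1+f≤

  last-term-symmetry : ∀ {f K′} → (+ r) ≡ (+ f - + r) [mod m ] →
                 m + r + K′ * m ≤ f → f < m + r + suc K′ * m → m + r + (m + r) + K′ * m ≡ f + m
  last-term-symmetry {f} {K′} r≡f-r L≤f f<L+m = begin
      m + r + (m + r) + K′ * m  ≡⟨ solve 3 (λ m r K → m :+ r :+ (m :+ r) :+ K :* m := m :+ r :+ K :* m :+ r :+ m)
                                          refl m r K′ ⟩
      L + r + m                 ≡⟨ cong (λ x → L + x + m) r≡D ⟩
      L + D + m                 ≡⟨ cong (_+ m) L+D≡f ⟩
      f + m                     ∎
    where
    open ≡-Reasoning
    L = m + r + K′ * m
    D = f ∸ L
    L+D≡f : L + D ≡ f
    L+D≡f = ℕP.m+[n∸m]≡n L≤f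
    D<m : D < m
    D<m = ℕP.+-cancelˡ-< L D m (subst₂ _<_ (sym L+D≡f) (sym (progression-next (m + r) m K′)) f<L+m)
    r-D≡ : (+ r - (+ f - + r)) ℤ.+ + suc K′ ℤ.* + m ≡ + r - + D
    r-D≡ = begin
        (+ r - (+ f - + r)) ℤ.+ + suc K′ ℤ.* + m
      ≡⟨ cong₂ (λ F K → (+ r - (F - + r)) ℤ.+ K ℤ.* + m) +f≡ (ℤP.pos-+ 1 K′) ⟩
        (+ r - ((+ m ℤ.+ + r ℤ.+ + K′ ℤ.* + m ℤ.+ + D) - + r)) ℤ.+ (+ 1 ℤ.+ + K′) ℤ.* + m
      ≡⟨ ℤsolve 4 (λ m r K D → (r :-ℤ ((m :+ℤ r :+ℤ K :*ℤ m :+ℤ D) :-ℤ r)) :+ℤ (conℤ (+ 1) :+ℤ K) :*ℤ m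
                               :=ℤ r :-ℤ D) refl (+ m) (+ r) (+ K′) (+ D) ⟩
        + r - + D
      ∎
      where
      +f≡ : + f ≡ + m ℤ.+ + r ℤ.+ + K′ ℤ.* + m ℤ.+ + D
      +f≡ = begin
        + f                                     ≡⟨ cong +_ L+D≡f ⟨
        + (m + r + K′ * m + D)                  ≡⟨ ℤP.pos-+ L D ⟩
        + (m + r + K′ * m) ℤ.+ + D              ≡⟨ cong (ℤ._+ + D) (ℤP.pos-+ (m + r) (K′ * m)) ⟩
        + (m + r) ℤ.+ + (K′ * m) ℤ.+ + D        ≡⟨ cong₂ (λ x y → x ℤ.+ y ℤ.+ + D)
                                                      (ℤP.pos-+ m r) (ℤP.pos-* K′ m) ⟩
        + m ℤ.+ + r ℤ.+ + K′ ℤ.* + m ℤ.+ + D   ∎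
    r≡D : r ≡ D
    r≡D = residue-unique r<m D<m (Sg.∣⇒∣ᵤ (subst (Sg._∣_ (+ m)) r-D≡
      (Sg.∣m∣n⇒∣m+n (Sg.∣ᵤ⇒∣ {+ m} {+ r - (+ f - + r)} r≡f-r)
                    (Sg.∣n⇒∣m*n (+ suc K′) (Sg.∣-refl {+ m})))))

  S-symmetric : ∀ {f} → (+ r) ≡ (+ f - + r) [mod m ] → SymmetricProgression m f (S m f r)
  S-symmetric {f} r≡f-r with S-progression r≡f-r
  ... | zero , S≡ , _ , _ = subst (SymmetricProgression m f) (sym S≡) empty
  ... | suc K′ , S≡ , ≤f , f< = subst (SymmetricProgression m f) (sym S≡)
    (symmetric (last-term-symmetry {K′ = K′} r≡f-r (All.lookup ≤f (∈-progression⁺ (ℕP.n<1+n K′))) f<))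

lemma15 : (m f d r : ℕ) → 0 < m → 0 < f → 0 < d → d < f
    → r ≤ m ∸ 1 → (+ r) ≡ (+ f - + r) [mod m ]
    → (length (S m f r) ≡ I m f r)
      × (w m f d (S m f r) ≤√ (embed ((+ 1618) / 1000) ^ℕ length (S m f r)))
lemma15 (suc m′) f d r _ _ _ _ r≤m′ r≡f-r =
  cong length (S≡congruent-interval {suc m′} {f} {r} r≡f-r) ,
  weight-bound (from-yes (1ℚ ℚP.≤? golden)) (from-yes (two ℚP.≤? golden ℚ.* golden))
    (S-symmetric (s≤s r≤m′) r≡f-r)
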